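{- Let $\varphi$ be a first-order formula, $x$ a variable and $t$ a term free for $x$ in $\varphi$. Then (a) $\models_{\sf QBD2}\forall x\varphi\to\varphi[x/t]$; (b) $\models_{\sf QBD2}\neg\forall x\varphi\to\neg\forall x\neg\neg\varphi$; (c) $\models_{\sf QBD2}\neg\varphi[x/t]\to\neg\forall x\varphi$.
   Context: $\varphi[x/t]$ denotes the result of substituting $t$ for the free occurrences of $x$ in $\varphi$. Let $\mathbf 4=\{1,\mathbf b,\mathbf n,0\}$ be the (complete) lattice with $0<\mathbf b<1$, $0<\mathbf n<1$, $\mathbf b,\mathbf n$ incomparable, with operations $\wedge,\vee$ (meet, join), $\neg$ ($\neg1=0$, $\neg\mathbf b=\mathbf b$, $\neg\mathbf n=\mathbf n$, $\neg0=1$), $\copyright$ ($\copyright1=1$, $\copyright\mathbf b=0$, $\copyright\mathbf n=\mathbf b$, $\copyright0=1$), $\to$ ($x\to y=y$ if $x\in\{1,\mathbf b\}$; $0\to y=1$; $\mathbf n\to1=\mathbf n\to\mathbf n=1$, $\mathbf n\to\mathbf b=\mathbf n\to0=\mathbf b$). A ${\sf QBD2}$-structure $\mathfrak A$ over a first-order signature has nonempty domain $A$, interprets $n$-ary predicates as maps $A^n\to\mathbf 4$, functions and constants as usual; for assignments $s:\mathcal V\to A$, atomic formulas get $P^{\mathfrak A}$ of the term values, connectives are evaluated by the operations of $\mathbf 4$, $[\![\forall x\varphi]\!](s)=\inf_{a\in A}[\![\varphi]\!](s^a_x)$, $[\![\exists x\varphi]\!](s)=\sup_{a\in A}[\![\varphi]\!](s^a_x)$.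 $\mathfrak A$ is a model of $\varphi$ if $[\![\varphi]\!](s)\in\{1,\mathbf b\}$ for every assignment $s$; $\Delta\models_{\sf QBD2}\varphi$ iff every model of all formulas of $\Delta$ is a model of $\varphi$; $\models_{\sf QBD2}\varphi$ means $\emptyset\models_{\sf QBD2}\varphi$. -}

module Defs where

open import Data.Nat using (ℕ; _≟_)
open import Data.Vec using (Vec; []; _∷_)
open import Data.Empty using (⊥)
open import Relation.Nullary using (¬_; yes; no)
open import Relation.Binary.PropositionalEquality using (_≡_)

data Four : Set where
  one b n zero : Four

data _≤₄_ : Four → Four → Set where
  refl≤ : ∀ {x} → x ≤₄ x
  zero≤ : ∀ {x} → zero ≤₄ x
  ≤one  : ∀ {x} → x ≤₄ one

_∧₄_ : Four → Four → Four
one ∧₄ y = y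
zero ∧₄ y = zero
b ∧₄ one = b
b ∧₄ b = b
b ∧₄ n = zero
b ∧₄ zero = zero
n ∧₄ one = n
n ∧₄ b = zero
n ∧₄ n = n
n ∧₄ zero = zero

_∨₄_ : Four → Four → Four
one ∨₄ y = one
zero ∨₄ y = y
b ∨₄ one = one
b ∨₄ b = b
b ∨₄ n = one
b ∨₄ zero = b
n ∨₄ one = one
n ∨₄ b = one
n ∨₄ n = n
n ∨₄ zero = n

¬₄_ : Four → Four
¬₄ one = zero
¬₄ b = b
¬₄ n = n
¬₄ zero = one

©₄_ : Four → Four
©₄ one = one
©₄ b = zero
©₄ n = b
©₄ zero = one

_⇒₄_ : Four → Four → Four
one ⇒₄ y = y
b ⇒₄ y = y
zero ⇒₄ y = one
n ⇒₄ one = one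
n ⇒₄ n = one
n ⇒₄ b = b
n ⇒₄ zero = b

data Designated : Four → Set where
  des-one : Designated one
  des-b   : Designated b

record Signature : Set₁ where
  field
    FunSym    : Set
    funArity  : FunSym → ℕ
    PredSym   : Set
    predArity : PredSym → ℕ
open Signature

Var : Set
Var = ℕ

module _ (Σ : Signature) where

  data Term : Set where
    var : Var → Term
    app : (f : FunSym Σ) → Vec Term (funArity Σ f) → Term

  data Formula : Set where
    atom  : (P : PredSym Σ) → Vec Term (predArity Σ P) → Formula
    _∧̇_ _∨̇_ _⇒̇_ : Formula → Formula → Formula
    ¬̇_ ©̇_ : Formula → Formula
    ∀̇ ∃̇ : Var → Formula → Formula

module Syntax {Σ : Signature} where

  mutual
    data OccursT (x : Var) : Term Σ → Set where
      occ-var : OccursT x (var x)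
      occ-app : ∀ {f ts} → OccursTs x ts → OccursT x (app f ts)

    data OccursTs (x : Var) : ∀ {k} → Vec (Term Σ) k → Set where
      occ-here  : ∀ {k t} {ts : Vec (Term Σ) k} → OccursT x t → OccursTs x (t ∷ ts)
      occ-there : ∀ {k t} {ts : Vec (Term Σ) k} → OccursTs x ts → OccursTs x (t ∷ ts)

  data FreeIn (x : Var) : Formula Σ → Set where
    fr-atom : ∀ {P ts} → OccursTs x ts → FreeIn x (atom P ts)
    fr-∧ˡ : ∀ {φ ψ} → FreeIn x φ → FreeIn x (φ ∧̇ ψ)
    fr-∧ʳ : ∀ {φ ψ} → FreeIn x ψ → FreeIn x (φ ∧̇ ψ)
    fr-∨ˡ : ∀ {φ ψ} → FreeIn x φ → FreeIn x (φ ∨̇ ψ)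
    fr-∨ʳ : ∀ {φ ψ} → FreeIn x ψ → FreeIn x (φ ∨̇ ψ)
    fr-⇒ˡ : ∀ {φ ψ} → FreeIn x φ → FreeIn x (φ ⇒̇ ψ)
    fr-⇒ʳ : ∀ {φ ψ} → FreeIn x ψ → FreeIn x (φ ⇒̇ ψ)
    fr-¬  : ∀ {φ} → FreeIn x φ → FreeIn x (¬̇ φ)
    fr-©  : ∀ {φ} → FreeIn x φ → FreeIn x (©̇ φ)
    fr-∀  : ∀ {y φ} → ¬ (x ≡ y) → FreeIn x φ → FreeIn x (∀̇ y φ)
    fr-∃  : ∀ {y φ} → ¬ (x ≡ y) → FreeIn x φ → FreeIn x (∃̇ y φ)

  mutual
    substT : Term Σ → Var → Term Σ → Term Σ
    substT (var y) x t with y ≟ x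
    ... | yes _ = t
    ... | no  _ = var y
    substT (app f ts) x t = app f (substTs ts x t)

    substTs : ∀ {k} → Vec (Term Σ) k → Var → Term Σ → Vec (Term Σ) k
    substTs [] x t = []
    substTs (u ∷ us) x t = substT u x t ∷ substTs us x t

  _[_/_] : Formula Σ → Var → Term Σ → Formula Σ
  atom P ts [ x / t ] = atom P (substTs ts x t)
  (φ ∧̇ ψ) [ x / t ] = (φ [ x / t ]) ∧̇ (ψ [ x / t ])
  (φ ∨̇ ψ) [ x / t ] = (φ [ x / t ]) ∨̇ (ψ [ x / t ])
  (φ ⇒̇ ψ) [ x / t ] = (φ [ x / t ]) ⇒̇ (ψ [ x / t ])
  (¬̇ φ) [ x / t ] = ¬̇ (φ [ x / t ])
  (©̇ φ) [ x / t ] = ©̇ (φ [ x / t ])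
  ∀̇ y φ [ x / t ] with y ≟ x
  ... | yes _ = ∀̇ y φ
  ... | no  _ = ∀̇ y (φ [ x / t ])
  ∃̇ y φ [ x / t ] with y ≟ x
  ... | yes _ = ∃̇ y φ
  ... | no  _ = ∃̇ y (φ [ x / t ])

  data FreeFor (t : Term Σ) (x : Var) : Formula Σ → Set where
    ff-atom : ∀ {P ts} → FreeFor t x (atom P ts)
    ff-∧ : ∀ {φ ψ} → FreeFor t x φ → FreeFor t x ψ → FreeFor t x (φ ∧̇ ψ)
    ff-∨ : ∀ {φ ψ} → FreeFor t x φ → FreeFor t x ψ → FreeFor t x (φ ∨̇ ψ)
    ff-⇒ : ∀ {φ ψ} → FreeFor t x φ → FreeFor t x ψ → FreeFor t x (φ ⇒̇ ψ)
    ff-¬ : ∀ {φ} → FreeFor t x φ → FreeFor t x (¬̇ φ)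
    ff-© : ∀ {φ} → FreeFor t x φ → FreeFor t x (©̇ φ)
    ff-∀-notfree : ∀ {y φ} → ¬ FreeIn x (∀̇ y φ) → FreeFor t x (∀̇ y φ)
    ff-∀ : ∀ {y φ} → ¬ OccursT y t → FreeFor t x φ → FreeFor t x (∀̇ y φ)
    ff-∃-notfree : ∀ {y φ} → ¬ FreeIn x (∃̇ y φ) → FreeFor t x (∃̇ y φ)
    ff-∃ : ∀ {y φ} → ¬ OccursT y t → FreeFor t x φ → FreeFor t x (∃̇ y φ)

open Syntax public

record Structure (Σ : Signature) : Set₁ where
  field
    Carrier  : Set
    inhabitant : Carrier
    funI     : (f : FunSym Σ) → Vec Carrier (funArity Σ f) → Carrier
    predI    : (P : PredSym Σ) → Vec Carrier (predArity Σ P) → Four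

-- Completeness of 4: for any domain A, infima and suprema of A-indexed
-- families exist (classically always true; unique when they exist).
-- Constructively we take them as a given witness.
record InfSup (A : Set) : Set where
  field
    inf : (A → Four) → Four
    inf-lb  : ∀ f a → inf f ≤₄ f a
    inf-glb : ∀ f w → (∀ a → w ≤₄ f a) → w ≤₄ inf f
    sup : (A → Four) → Four
    sup-ub  : ∀ f a → f a ≤₄ sup f
    sup-lub : ∀ f w → (∀ a → f a ≤₄ w) → sup f ≤₄ w

module Semantics {Σ : Signature} (𝔄 : Structure Σ) (L : InfSup (Structure.Carrier 𝔄)) where
  open Structure 𝔄
  open InfSup L

  Assignment : Set
  Assignment = Var → Carrier

  _[_↦_] : Assignment → Var → Carrier → Assignment
  (s [ x ↦ a ]) y with y ≟ x
  ... | yes _ = a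
  ... | no  _ = s y

  mutual
    evalT : Term Σ → Assignment → Carrier
    evalT (var x) s = s x
    evalT (app f ts) s = funI f (evalTs ts s)

    evalTs : ∀ {k} → Vec (Term Σ) k → Assignment → Vec Carrier k
    evalTs [] s = []
    evalTs (t ∷ ts) s = evalT t s ∷ evalTs ts s

  ⟦_⟧ : Formula Σ → Assignment → Four
  ⟦ atom P ts ⟧ s = predI P (evalTs ts s)
  ⟦ φ ∧̇ ψ ⟧ s = ⟦ φ ⟧ s ∧₄ ⟦ ψ ⟧ s
  ⟦ φ ∨̇ ψ ⟧ s = ⟦ φ ⟧ s ∨₄ ⟦ ψ ⟧ s
  ⟦ φ ⇒̇ ψ ⟧ s = ⟦ φ ⟧ s ⇒₄ ⟦ ψ ⟧ s
  ⟦ ¬̇ φ ⟧ s = ¬₄ ⟦ φ ⟧ s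
  ⟦ ©̇ φ ⟧ s = ©₄ ⟦ φ ⟧ s
  ⟦ ∀̇ x φ ⟧ s = inf (λ a → ⟦ φ ⟧ (s [ x ↦ a ]))
  ⟦ ∃̇ x φ ⟧ s = sup (λ a → ⟦ φ ⟧ (s [ x ↦ a ]))

  IsModel : Formula Σ → Set
  IsModel φ = ∀ (s : Assignment) → Designated (⟦ φ ⟧ s)

⊨QBD2 : {Σ : Signature} → Formula Σ → Set₁
⊨QBD2 {Σ} φ = (𝔄 : Structure Σ) (L : InfSup (Structure.Carrier 𝔄)) → Semantics.IsModel 𝔄 L φ

-- The substitution lemma ⟦ φ [ x / t ] ⟧ s ≡ ⟦ φ ⟧ (s [ x ↦ ⟦ t ⟧ s ]), valid when t is
-- free for x in φ, shows that ⟦ φ [ x / t ] ⟧ s is one of the values whose infimum is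
-- ⟦ ∀̇ x φ ⟧ s, so ⟦ ∀̇ x φ ⟧ s ≤ ⟦ φ [ x / t ] ⟧ s.  In 4, u ≤ v makes u ⇒ v designated,
-- which gives (a); since ¬ is antitone it also gives (c); and since ¬ is an involution,
-- ∀̇ x (¬̇ ¬̇ φ) and ∀̇ x φ take the same value, which gives (b).
module Submission where

open import Defs
open import Data.Product using (_×_; _,_)
open import Data.Nat using (_≟_)
open import Data.Vec using (Vec; []; _∷_)
open import Data.Empty using (⊥-elim)
open import Relation.Nullary using (¬_; yes; no)
open import Relation.Binary.PropositionalEquality
  using (_≡_; refl; sym; trans; cong; cong₂; subst; module ≡-Reasoning)

≤₄-antisym : ∀ {u v} → u ≤₄ v → v ≤₄ u → u ≡ v
≤₄-antisym refl≤ _     = refl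
≤₄-antisym zero≤ refl≤ = refl
≤₄-antisym zero≤ zero≤ = refl
≤₄-antisym ≤one  refl≤ = refl
≤₄-antisym ≤one  ≤one  = refl

≤₄⇒designated-⇒₄ : ∀ {u v} → u ≤₄ v → Designated (u ⇒₄ v)
≤₄⇒designated-⇒₄ {one}  refl≤ = des-one
≤₄⇒designated-⇒₄ {b}    refl≤ = des-b
≤₄⇒designated-⇒₄ {n}    refl≤ = des-one
≤₄⇒designated-⇒₄ {zero} refl≤ = des-one
≤₄⇒designated-⇒₄        zero≤ = des-one
≤₄⇒designated-⇒₄ {one}  ≤one  = des-one
≤₄⇒designated-⇒₄ {b}    ≤one  = des-one
≤₄⇒designated-⇒₄ {n}    ≤one  = des-one
≤₄⇒designated-⇒₄ {zero} ≤one  = des-one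

¬₄-antitone : ∀ {u v} → u ≤₄ v → (¬₄ v) ≤₄ (¬₄ u)
¬₄-antitone refl≤ = refl≤
¬₄-antitone zero≤ = ≤one
¬₄-antitone ≤one  = zero≤

¬₄-involutive : ∀ u → ¬₄ (¬₄ u) ≡ u
¬₄-involutive one  = refl
¬₄-involutive b    = refl
¬₄-involutive n    = refl
¬₄-involutive zero = refl

-- inf and sup are arbitrary functions on A → Four; without function extensionality
-- their respect for pointwise equality has to come from uniqueness of bounds.
module _ {A : Set} (L : InfSup A) where
  open InfSup L

  inf-cong : ∀ {f g : A → Four} → (∀ a → f a ≡ g a) → inf f ≡ inf g
  inf-cong {f} {g} f≗g = ≤₄-antisym
    (inf-glb g (inf f) λ a → subst (inf f ≤₄_) (f≗g a) (inf-lb f a))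
    (inf-glb f (inf g) λ a → subst (inf g ≤₄_) (sym (f≗g a)) (inf-lb g a))

  sup-cong : ∀ {f g : A → Four} → (∀ a → f a ≡ g a) → sup f ≡ sup g
  sup-cong {f} {g} f≗g = ≤₄-antisym
    (sup-lub f (sup g) λ a → subst (_≤₄ sup g) (sym (f≗g a)) (sup-ub g a))
    (sup-lub g (sup f) λ a → subst (_≤₄ sup f) (f≗g a) (sup-ub f a))

module _ {Σ : Signature} where

  mutual
    substT-notOccurs : ∀ u x (t : Term Σ) → ¬ OccursT x u → substT u x t ≡ u
    substT-notOccurs (var y) x t x∉u with y ≟ x
    ... | yes refl = ⊥-elim (x∉u occ-var)
    ... | no _     = refl
    substT-notOccurs (app f us) x t x∉u =
      cong (app f) (substTs-notOccurs us x t λ o → x∉u (occ-app o))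

    substTs-notOccurs : ∀ {k} (us : Vec (Term Σ) k) x t → ¬ OccursTs x us → substTs us x t ≡ us
    substTs-notOccurs []       x t x∉us = refl
    substTs-notOccurs (u ∷ us) x t x∉us = cong₂ _∷_
      (substT-notOccurs u x t λ o → x∉us (occ-here o))
      (substTs-notOccurs us x t λ o → x∉us (occ-there o))

  subst-notFree : ∀ (φ : Formula Σ) x t → ¬ FreeIn x φ → φ [ x / t ] ≡ φ
  subst-notFree (atom P ts) x t nf = cong (atom P) (substTs-notOccurs ts x t λ o → nf (fr-atom o))
  subst-notFree (φ ∧̇ ψ) x t nf =
    cong₂ _∧̇_ (subst-notFree φ x t λ f → nf (fr-∧ˡ f)) (subst-notFree ψ x t λ f → nf (fr-∧ʳ f))
  subst-notFree (φ ∨̇ ψ) x t nf =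
    cong₂ _∨̇_ (subst-notFree φ x t λ f → nf (fr-∨ˡ f)) (subst-notFree ψ x t λ f → nf (fr-∨ʳ f))
  subst-notFree (φ ⇒̇ ψ) x t nf =
    cong₂ _⇒̇_ (subst-notFree φ x t λ f → nf (fr-⇒ˡ f)) (subst-notFree ψ x t λ f → nf (fr-⇒ʳ f))
  subst-notFree (¬̇ φ) x t nf = cong ¬̇_ (subst-notFree φ x t λ f → nf (fr-¬ f))
  subst-notFree (©̇ φ) x t nf = cong ©̇_ (subst-notFree φ x t λ f → nf (fr-© f))
  subst-notFree (∀̇ y φ) x t nf with y ≟ x
  ... | yes _  = refl
  ... | no y≢x = cong (∀̇ y) (subst-notFree φ x t λ f → nf (fr-∀ (λ x≡y → y≢x (sym x≡y)) f))
  subst-notFree (∃̇ y φ) x t nf with y ≟ x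
  ... | yes _  = refl
  ... | no y≢x = cong (∃̇ y) (subst-notFree φ x t λ f → nf (fr-∃ (λ x≡y → y≢x (sym x≡y)) f))

  ∀-bound-notFree : ∀ x (φ : Formula Σ) → ¬ FreeIn x (∀̇ x φ)
  ∀-bound-notFree x φ (fr-∀ x≢x _) = x≢x refl

  ∃-bound-notFree : ∀ x (φ : Formula Σ) → ¬ FreeIn x (∃̇ x φ)
  ∃-bound-notFree x φ (fr-∃ x≢x _) = x≢x refl

module Properties {Σ : Signature} (𝔄 : Structure Σ) (L : InfSup (Structure.Carrier 𝔄)) where
  open Structure 𝔄
  open InfSup L
  open Semantics 𝔄 L

  update-≡ : ∀ s x a → (s [ x ↦ a ]) x ≡ a
  update-≡ s x a with x ≟ x
  ... | yes _   = refl
  ... | no x≢x = ⊥-elim (x≢x refl)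

  update-≢ : ∀ s x a z → ¬ z ≡ x → (s [ x ↦ a ]) z ≡ s z
  update-≢ s x a z z≢x with z ≟ x
  ... | yes z≡x = ⊥-elim (z≢x z≡x)
  ... | no _    = refl

  update-cong : ∀ s s' y a z → (¬ z ≡ y → s z ≡ s' z) → (s [ y ↦ a ]) z ≡ (s' [ y ↦ a ]) z
  update-cong s s' y a z agree with z ≟ y
  ... | yes _   = refl
  ... | no z≢y = agree z≢y

  mutual
    evalT-coincidence : ∀ u s s' → (∀ z → OccursT z u → s z ≡ s' z) → evalT u s ≡ evalT u s'
    evalT-coincidence (var y)    s s' agree = agree y occ-var
    evalT-coincidence (app f us) s s' agree =
      cong (funI f) (evalTs-coincidence us s s' λ z o → agree z (occ-app o))

    evalTs-coincidence : ∀ {k} (us : Vec (Term Σ) k) s s' →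
      (∀ z → OccursTs z us → s z ≡ s' z) → evalTs us s ≡ evalTs us s'
    evalTs-coincidence []       s s' agree = refl
    evalTs-coincidence (u ∷ us) s s' agree = cong₂ _∷_
      (evalT-coincidence u s s' λ z o → agree z (occ-here o))
      (evalTs-coincidence us s s' λ z o → agree z (occ-there o))

  coincidence : ∀ φ s s' → (∀ z → FreeIn z φ → s z ≡ s' z) → ⟦ φ ⟧ s ≡ ⟦ φ ⟧ s'
  coincidence (atom P ts) s s' agree =
    cong (predI P) (evalTs-coincidence ts s s' λ z o → agree z (fr-atom o))
  coincidence (φ ∧̇ ψ) s s' agree = cong₂ _∧₄_
    (coincidence φ s s' λ z f → agree z (fr-∧ˡ f)) (coincidence ψ s s' λ z f → agree z (fr-∧ʳ f))
  coincidence (φ ∨̇ ψ) s s' agree = cong₂ _∨₄_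
    (coincidence φ s s' λ z f → agree z (fr-∨ˡ f)) (coincidence ψ s s' λ z f → agree z (fr-∨ʳ f))
  coincidence (φ ⇒̇ ψ) s s' agree = cong₂ _⇒₄_
    (coincidence φ s s' λ z f → agree z (fr-⇒ˡ f)) (coincidence ψ s s' λ z f → agree z (fr-⇒ʳ f))
  coincidence (¬̇ φ) s s' agree = cong ¬₄_ (coincidence φ s s' λ z f → agree z (fr-¬ f))
  coincidence (©̇ φ) s s' agree = cong ©₄_ (coincidence φ s s' λ z f → agree z (fr-© f))
  coincidence (∀̇ y φ) s s' agree = inf-cong L λ a → coincidence φ _ _ λ z f →
    update-cong s s' y a z λ z≢y → agree z (fr-∀ z≢y f)
  coincidence (∃̇ y φ) s s' agree = sup-cong L λ a → coincidence φ _ _ λ z f →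
    update-cong s s' y a z λ z≢y → agree z (fr-∃ z≢y f)

  eval-update-notFree : ∀ φ s x a → ¬ FreeIn x φ → ⟦ φ ⟧ s ≡ ⟦ φ ⟧ (s [ x ↦ a ])
  eval-update-notFree φ s x a x∉φ = coincidence φ _ _ agree
    where
    agree : ∀ z → FreeIn z φ → s z ≡ (s [ x ↦ a ]) z
    agree z z∈φ with z ≟ x
    ... | yes refl = ⊥-elim (x∉φ z∈φ)
    ... | no _     = refl

  mutual
    evalT-substT : ∀ u x t s → evalT (substT u x t) s ≡ evalT u (s [ x ↦ evalT t s ])
    evalT-substT (var y) x t s with y ≟ x
    ... | yes _ = refl
    ... | no _  = refl
    evalT-substT (app f us) x t s = cong (funI f) (evalTs-substTs us x t s)

    evalTs-substTs : ∀ {k} (us : Vec (Term Σ) k) x t s →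
      evalTs (substTs us x t) s ≡ evalTs us (s [ x ↦ evalT t s ])
    evalTs-substTs []       x t s = refl
    evalTs-substTs (u ∷ us) x t s = cong₂ _∷_ (evalT-substT u x t s) (evalTs-substTs us x t s)

  update-substT-comm : ∀ s x y t a z → ¬ y ≡ x → ¬ OccursT y t →
    ((s [ y ↦ a ]) [ x ↦ evalT t (s [ y ↦ a ]) ]) z ≡ ((s [ x ↦ evalT t s ]) [ y ↦ a ]) z
  update-substT-comm s x y t a z y≢x y∉t with z ≟ x
  ... | yes refl = begin
      evalT t (s [ y ↦ a ])                  ≡⟨ t-unchanged ⟩
      evalT t s                              ≡⟨ sym (update-≡ s z (evalT t s)) ⟩
      (s [ z ↦ evalT t s ]) z                ≡⟨ sym (update-≢ _ y a z λ z≡y → y≢x (sym z≡y)) ⟩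
      ((s [ z ↦ evalT t s ]) [ y ↦ a ]) z    ∎
    where
    open ≡-Reasoning
    t-unchanged : evalT t (s [ y ↦ a ]) ≡ evalT t s
    t-unchanged = evalT-coincidence t _ _ λ w o →
      update-≢ s y a w λ w≡y → y∉t (subst (λ v → OccursT v t) w≡y o)
  ... | no z≢x with z ≟ y
  ...   | yes _ = refl
  ...   | no _  = sym (update-≢ s x _ z z≢x)

  subst-notFree-eval : ∀ φ x t s a → ¬ FreeIn x φ → ⟦ φ [ x / t ] ⟧ s ≡ ⟦ φ ⟧ (s [ x ↦ a ])
  subst-notFree-eval φ x t s a x∉φ =
    trans (cong (λ ψ → ⟦ ψ ⟧ s) (subst-notFree φ x t x∉φ)) (eval-update-notFree φ s x a x∉φ)

  substitution : ∀ φ x t s → FreeFor t x φ → ⟦ φ [ x / t ] ⟧ s ≡ ⟦ φ ⟧ (s [ x ↦ evalT t s ])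
  substitution (atom P ts) x t s ff-atom = cong (predI P) (evalTs-substTs ts x t s)
  substitution (φ ∧̇ ψ) x t s (ff-∧ ffφ ffψ) = cong₂ _∧₄_ (substitution φ x t s ffφ) (substitution ψ x t s ffψ)
  substitution (φ ∨̇ ψ) x t s (ff-∨ ffφ ffψ) = cong₂ _∨₄_ (substitution φ x t s ffφ) (substitution ψ x t s ffψ)
  substitution (φ ⇒̇ ψ) x t s (ff-⇒ ffφ ffψ) = cong₂ _⇒₄_ (substitution φ x t s ffφ) (substitution ψ x t s ffψ)
  substitution (¬̇ φ) x t s (ff-¬ ffφ) = cong ¬₄_ (substitution φ x t s ffφ)
  substitution (©̇ φ) x t s (ff-© ffφ) = cong ©₄_ (substitution φ x t s ffφ)
  substitution (∀̇ y φ) x t s (ff-∀-notfree x∉) = subst-notFree-eval (∀̇ y φ) x t s _ x∉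
  substitution (∀̇ y φ) x t s (ff-∀ y∉t ffφ) with y ≟ x
  ... | yes refl = eval-update-notFree (∀̇ y φ) s y _ (∀-bound-notFree y φ)
  ... | no y≢x   = inf-cong L λ a → trans (substitution φ x t (s [ y ↦ a ]) ffφ)
                     (coincidence φ _ _ λ z _ → update-substT-comm s x y t a z y≢x y∉t)
  substitution (∃̇ y φ) x t s (ff-∃-notfree x∉) = subst-notFree-eval (∃̇ y φ) x t s _ x∉
  substitution (∃̇ y φ) x t s (ff-∃ y∉t ffφ) with y ≟ x
  ... | yes refl = eval-update-notFree (∃̇ y φ) s y _ (∃-bound-notFree y φ)
  ... | no y≢x   = sup-cong L λ a → trans (substitution φ x t (s [ y ↦ a ]) ffφ)
                     (coincidence φ _ _ λ z _ → update-substT-comm s x y t a z y≢x y∉t)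

  ∀-instance-≤ : ∀ φ x t s → FreeFor t x φ → ⟦ ∀̇ x φ ⟧ s ≤₄ ⟦ φ [ x / t ] ⟧ s
  ∀-instance-≤ φ x t s ff = subst (_ ≤₄_) (sym (substitution φ x t s ff)) (inf-lb _ (evalT t s))

  ∀¬¬-eval : ∀ φ x s → ⟦ ∀̇ x (¬̇ (¬̇ φ)) ⟧ s ≡ ⟦ ∀̇ x φ ⟧ s
  ∀¬¬-eval φ x s = inf-cong L λ a → ¬₄-involutive _

  isModel-∀-elim : ∀ φ x t → FreeFor t x φ → IsModel ((∀̇ x φ) ⇒̇ (φ [ x / t ]))
  isModel-∀-elim φ x t ff s = ≤₄⇒designated-⇒₄ (∀-instance-≤ φ x t s ff)

  isModel-¬∀⇒¬∀¬¬ : ∀ φ x → IsModel ((¬̇ (∀̇ x φ)) ⇒̇ (¬̇ (∀̇ x (¬̇ (¬̇ φ)))))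
  isModel-¬∀⇒¬∀¬¬ φ x s rewrite ∀¬¬-eval φ x s = ≤₄⇒designated-⇒₄ {¬₄ ⟦ ∀̇ x φ ⟧ s} refl≤

  isModel-¬instance⇒¬∀ : ∀ φ x t → FreeFor t x φ → IsModel ((¬̇ (φ [ x / t ])) ⇒̇ (¬̇ (∀̇ x φ)))
  isModel-¬instance⇒¬∀ φ x t ff s = ≤₄⇒designated-⇒₄ (¬₄-antitone (∀-instance-≤ φ x t s ff))

mainTheorem11 : {Σ : Signature} (φ : Formula Σ) (x : Var) (t : Term Σ) →
    FreeFor t x φ →
    ⊨QBD2 ((∀̇ x φ) ⇒̇ (φ [ x / t ]))
    × ⊨QBD2 ((¬̇ (∀̇ x φ)) ⇒̇ (¬̇ (∀̇ x (¬̇ (¬̇ φ)))))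
    × ⊨QBD2 ((¬̇ (φ [ x / t ])) ⇒̇ (¬̇ (∀̇ x φ)))
mainTheorem11 φ x t ff =
  (λ 𝔄 L → Properties.isModel-∀-elim 𝔄 L φ x t ff) ,
  (λ 𝔄 L → Properties.isModel-¬∀⇒¬∀¬¬ 𝔄 L φ x) ,
  (λ 𝔄 L → Properties.isModel-¬instance⇒¬∀ 𝔄 L φ x t ff)
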